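{- Let $C$ be a cycle in the grid graph $G(m,n)$ and let $c$ be a cell of $C$. Then the union of the row and the column containing $c$ contains at least two turns of $C$.
   Context: $G(m,n)$ is the graph on cells $\{1,\dots,m\}\times\{1,\dots,n\}$ with $(a,b),(c,d)$ adjacent iff $|a-c|+|b-d|=1$. A row is the set of cells with a fixed second coordinate; a column is the set of cells with a fixed first coordinate. A turn of a cycle is a cell of the cycle whose two incident cycle edges are one horizontal and one vertical. -}

module Defs where

open import Data.Nat using (ℕ; zero; suc; _+_; _≤_; ∣_-_∣)
open import Data.Fin using (Fin; zero; suc; toℕ)
open import Data.Product using (_×_; _,_; proj₁; proj₂)
open import Data.Sum using (_⊎_)
open import Function.Definitions using (Injective)
open import Relation.Binary.PropositionalEquality using (_≡_)

-- A cell of G(m,n): first coordinate in {1..m}, second in {1..n},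
-- represented 0-based as Fin m × Fin n.
Cell : ℕ → ℕ → Set
Cell m n = Fin m × Fin n

Adj : ∀ {m n} → Cell m n → Cell m n → Set
Adj (a , b) (c , d) = ∣ toℕ a - toℕ c ∣ + ∣ toℕ b - toℕ d ∣ ≡ 1

cycSucc : ∀ {k} → Fin k → Fin k
cycSucc {suc zero} zero = zero
cycSucc {suc (suc k)} zero = suc zero
cycSucc {suc (suc k)} (suc i) with cycSucc {suc k} i
... | zero  = zero
... | suc j = suc (suc j)

cycPred : ∀ {k} → Fin k → Fin k
cycPred {suc k} zero = Data.Fin.fromℕ k
  where import Data.Fin
cycPred {suc (suc k)} (suc zero) = zero
cycPred {suc (suc k)} (suc (suc i)) = suc (cycPred {suc k} (suc i))

record Cycle (m n : ℕ) : Set where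
  field
    len      : ℕ
    len≥3    : 3 ≤ len
    vertex   : Fin len → Cell m n
    distinct : Injective _≡_ _≡_ vertex
    adjacent : ∀ i → Adj (vertex i) (vertex (cycSucc i))

Horizontal : ∀ {m n} → Cell m n → Cell m n → Set
Horizontal p q = proj₂ p ≡ proj₂ q

Vertical : ∀ {m n} → Cell m n → Cell m n → Set
Vertical p q = proj₁ p ≡ proj₁ q

OnCycle : ∀ {m n} → Cycle m n → Cell m n → Set
OnCycle C c = Data.Product.∃ λ i → Cycle.vertex C i ≡ c
  where import Data.Product

IsTurn : ∀ {m n} → Cycle m n → Cell m n → Set
IsTurn {m} {n} C t = Data.Product.∃ λ i → Cycle.vertex C i ≡ t ×
  ((Horizontal (v (cycPred i)) (v i) × Vertical (v i) (v (cycSucc i)))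
   ⊎ (Vertical (v (cycPred i)) (v i) × Horizontal (v i) (v (cycSucc i))))
  where
    import Data.Product
    v = Cycle.vertex C

InRowOrColumn : ∀ {m n} → Cell m n → Cell m n → Set
InRowOrColumn c t = proj₂ t ≡ proj₂ c ⊎ proj₁ t ≡ proj₁ c

module Submission where

-- Leave c along one of its cycle edges, say a horizontal one, and keep following the row of c.
-- The run cannot reverse (on a cycle of length at least 3 the cells before and after a cell
-- differ) and cannot go on past the border of the grid, so it stops at a turn strictly beyond c. If the other edge at c is vertical,
-- c itself is a second turn; otherwise the run leaving c the other way stops at a turn
-- strictly on the other side of c. A vertical edge at c is the same case with the
-- coordinates swapped.

open import Defs
open import Data.Nat using (ℕ)
open import Data.Product using (Σ; _×_)
open import Relation.Binary.PropositionalEquality using (_≢_)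

open import Data.Nat using (zero; suc; _+_; _≤_; _<_; ∣_-_∣; z≤n; s≤s; _≟_)
open import Data.Nat.Properties
  using (≤-refl; ≤-trans; <⇒≤; ≤-reflexive; <-trans; n≤1+n; ≤-pred; suc-injective; +-suc; +-comm;
         +-identityʳ; m≤m+n; <⇒≢; >⇒≢; <⇒≱; m+n≡0⇒m≡0; ∣-∣-comm; m≡n⇒∣m-n∣≡0; ∣m-n∣≡0⇒m≡n)
open import Data.Fin using (Fin; zero; suc; toℕ)
open import Data.Fin.Properties using (toℕ-injective; toℕ<n; toℕ-fromℕ)
open import Data.Product using (Σ-syntax; _,_; proj₁; proj₂; swap)
open import Data.Product.Properties using (×-≡,≡→≡)
import Data.Product as Product
open import Data.Sum using (_⊎_; inj₁; inj₂)
import Data.Sum as Sum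
open import Data.Empty using (⊥-elim)
open import Relation.Nullary using (yes; no)
open import Relation.Binary.PropositionalEquality
  using (_≡_; refl; sym; trans; cong; subst; ≢-sym)
open import Function using (_∘_)
open import Function.Definitions using (Injective)

toℕ-cycSucc : ∀ {k} (i : Fin k) →
  (suc (toℕ i) ≡ k × toℕ (cycSucc i) ≡ 0) ⊎ (suc (toℕ i) < k × toℕ (cycSucc i) ≡ suc (toℕ i))
toℕ-cycSucc {suc zero} zero = inj₁ (refl , refl)
toℕ-cycSucc {suc (suc k)} zero = inj₂ (s≤s (s≤s z≤n) , refl)
toℕ-cycSucc {suc (suc k)} (suc i) with cycSucc {suc k} i | toℕ-cycSucc {suc k} i
... | zero  | inj₁ (last , _) = inj₁ (cong suc last , refl)
... | suc j | inj₂ (i+1<k , eq) = inj₂ (s≤s i+1<k , cong suc eq)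

toℕ-cycPred : ∀ {k} (i : Fin k) →
  (toℕ i ≡ 0 × suc (toℕ (cycPred i)) ≡ k) ⊎ toℕ i ≡ suc (toℕ (cycPred i))
toℕ-cycPred {suc k} zero = inj₁ (refl , cong suc (toℕ-fromℕ k))
toℕ-cycPred {suc (suc k)} (suc zero) = inj₂ refl
toℕ-cycPred {suc (suc k)} (suc (suc i)) with toℕ-cycPred {suc k} (suc i)
... | inj₂ eq = inj₂ (cong suc eq)

cycPred-cycSucc : ∀ {k} (i : Fin k) → cycPred (cycSucc i) ≡ i
cycPred-cycSucc i with toℕ-cycSucc i | toℕ-cycPred (cycSucc i)
... | inj₁ (last , _) | inj₁ (_ , wrap) = toℕ-injective (suc-injective (trans wrap (sym last)))
... | inj₁ (_ , wrap) | inj₂ eq with () ← trans (sym wrap) eq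
... | inj₂ (_ , eq) | inj₁ (first , _) with () ← trans (sym eq) first
... | inj₂ (_ , eq) | inj₂ eq′ = toℕ-injective (sym (suc-injective (trans (sym eq) eq′)))

cycSucc-cycPred : ∀ {k} (i : Fin k) → cycSucc (cycPred i) ≡ i
cycSucc-cycPred i with toℕ-cycSucc (cycPred i) | toℕ-cycPred i
... | inj₁ (_ , eq) | inj₁ (first , _) = toℕ-injective (trans eq (sym first))
... | inj₁ (last , _) | inj₂ eq = ⊥-elim (<⇒≢ (toℕ<n i) (trans eq last))
... | inj₂ (i+1<k , _) | inj₁ (_ , wrap) = ⊥-elim (<⇒≢ i+1<k wrap)
... | inj₂ (_ , eq) | inj₂ eq′ = toℕ-injective (trans eq (sym eq′))

cycSucc≡cycPred⇒k≤2 : ∀ {k} (i : Fin k) → cycSucc i ≡ cycPred i → k ≤ 2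
cycSucc≡cycPred⇒k≤2 i same with toℕ-cycSucc i | toℕ-cycPred i | cong toℕ same
... | inj₁ (last , _) | inj₁ (first , _) | _ =
  subst (_≤ 2) (trans (cong suc (sym first)) last) (s≤s z≤n)
... | inj₁ (last , wrap) | inj₂ eq | same′ =
  ≤-reflexive (trans (sym last) (cong suc (trans eq (cong suc (trans (sym same′) wrap)))))
... | inj₂ (_ , eq) | inj₁ (first , wrap) | same′ =
  ≤-reflexive (trans (sym wrap) (cong suc (trans (sym same′) (trans eq (cong suc first)))))
... | inj₂ (_ , eq) | inj₂ eq′ | same′ =
  ⊥-elim (<⇒≢ (s≤s (n≤1+n _)) (trans eq′ (cong suc (trans (sym same′) eq))))

cycSucc≢cycPred : ∀ {k} → 3 ≤ k → (i : Fin k) → cycSucc i ≢ cycPred i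
cycSucc≢cycPred 3≤k i same = <⇒≱ (s≤s (cycSucc≡cycPred⇒k≤2 i same)) 3≤k

UnitStep : ℕ × ℕ → ℕ × ℕ → Set
UnitStep p q = ∣ proj₁ p - proj₁ q ∣ + ∣ proj₂ p - proj₂ q ∣ ≡ 1

StepRight : ℕ × ℕ → ℕ × ℕ → Set
StepRight p q = proj₂ p ≡ proj₂ q × proj₁ q ≡ suc (proj₁ p)

UnitStep-sym : ∀ {p q} → UnitStep p q → UnitStep q p
UnitStep-sym {a , b} {c , d} step rewrite ∣-∣-comm a c | ∣-∣-comm b d = step

UnitStep-swap : ∀ {p q} → UnitStep p q → UnitStep (swap p) (swap q)
UnitStep-swap {a , b} {c , d} step = trans (+-comm ∣ b - d ∣ ∣ a - c ∣) step

∣m-n∣≡1⇒n≡1+m⊎m≡1+n : ∀ m n → ∣ m - n ∣ ≡ 1 → n ≡ suc m ⊎ m ≡ suc n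
∣m-n∣≡1⇒n≡1+m⊎m≡1+n zero (suc zero) _ = inj₁ refl
∣m-n∣≡1⇒n≡1+m⊎m≡1+n (suc zero) zero _ = inj₂ refl
∣m-n∣≡1⇒n≡1+m⊎m≡1+n (suc m) (suc n) eq =
  Sum.map (cong suc) (cong suc) (∣m-n∣≡1⇒n≡1+m⊎m≡1+n m n eq)

UnitStep-sameRow : ∀ {p q} → UnitStep p q → proj₂ p ≡ proj₂ q → StepRight p q ⊎ StepRight q p
UnitStep-sameRow {a , b} {c , d} step b≡d rewrite m≡n⇒∣m-n∣≡0 b≡d | +-identityʳ ∣ a - c ∣ =
  Sum.map (b≡d ,_) (sym b≡d ,_) (∣m-n∣≡1⇒n≡1+m⊎m≡1+n a c step)

UnitStep-otherRow : ∀ {p q} → UnitStep p q → proj₂ p ≢ proj₂ q → proj₁ p ≡ proj₁ q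
UnitStep-otherRow {a , b} {c , d} step b≢d with ∣ b - d ∣ in b-d
... | zero  = ⊥-elim (b≢d (∣m-n∣≡0⇒m≡n b-d))
... | suc e =
  ∣m-n∣≡0⇒m≡n (m+n≡0⇒m≡0 ∣ a - c ∣ (suc-injective (trans (sym (+-suc ∣ a - c ∣ e)) step)))

Beyond : ℕ → ℕ → ℕ → Set
Beyond o d t = (d ≡ suc o × o < t) ⊎ (o ≡ suc d × t < o)

Beyond⇒≢ : ∀ {o d t} → Beyond o d t → t ≢ o
Beyond⇒≢ (inj₁ (_ , o<t)) = >⇒≢ o<t
Beyond⇒≢ (inj₂ (_ , t<o)) = <⇒≢ t<o

Beyond-opposite : ∀ {o d₁ d₂ t₁ t₂} → Beyond o d₁ t₁ → Beyond o d₂ t₂ → d₁ ≢ d₂ → t₁ ≢ t₂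
Beyond-opposite (inj₁ (up₁ , _)) (inj₁ (up₂ , _)) d₁≢d₂ = ⊥-elim (d₁≢d₂ (trans up₁ (sym up₂)))
Beyond-opposite (inj₂ (down₁ , _)) (inj₂ (down₂ , _)) d₁≢d₂ =
  ⊥-elim (d₁≢d₂ (suc-injective (trans (sym down₁) down₂)))
Beyond-opposite (inj₁ (_ , o<t₁)) (inj₂ (_ , t₂<o)) _ = >⇒≢ (<-trans t₂<o o<t₁)
Beyond-opposite (inj₂ (_ , t₁<o)) (inj₁ (_ , o<t₂)) _ = <⇒≢ (<-trans t₁<o o<t₂)

module StraightRuns {L : ℕ} (v : Fin L → ℕ × ℕ) (m : ℕ) (bounded : ∀ i → proj₁ (v i) < m)
  (next prev : Fin L → Fin L) (prev-next : ∀ i → prev (next i) ≡ i)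
  (no-backtrack : ∀ i → v (next i) ≢ v (prev i))
  (step : ∀ i → UnitStep (v i) (v (next i))) where

  x y : Fin L → ℕ
  x = proj₁ ∘ v
  y = proj₂ ∘ v

  RunEnd : Fin L → Set
  RunEnd k = y (prev k) ≡ y k × x k ≡ x (next k)

  record RunEndFrom (i : Fin L) (R : ℕ → ℕ → Set) : Set where
    constructor ends-at
    field
      k        : Fin L
      end      : RunEnd k
      same-row : y k ≡ y i
      position : R (x i) (x k)

  entering : ∀ (P : ℕ × ℕ → Set) {i} → P (v i) → P (v (prev (next i)))
  entering P {i} = subst (P ∘ v) (sym (prev-next i))

  end-or-straight : ∀ i → y (prev i) ≡ y i → RunEnd i ⊎ y (next i) ≡ y i
  end-or-straight i into with y (next i) ≟ y i
  ... | yes straight = inj₂ straight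
  ... | no bend = inj₁ (into , UnitStep-otherRow {v i} {v (next i)} (step i) (≢-sym bend))

  RunEndFrom-next : ∀ {i} {R S : ℕ → ℕ → Set} → y (next i) ≡ y i → RunEndFrom (next i) R →
                    (∀ {t} → R (x (next i)) t → S (x i) t) → RunEndFrom i S
  RunEndFrom-next straight (ends-at k end row rel) shift = ends-at k end (trans row straight) (shift rel)

  straight-right : ∀ {i} → StepRight (v (prev i)) (v i) → y (next i) ≡ y i →
                   StepRight (v i) (v (next i))
  straight-right {i} into straight with UnitStep-sameRow {v i} {v (next i)} (step i) (sym straight)
  ... | inj₁ right = right
  ... | inj₂ left = ⊥-elim (no-backtrack i (×-≡,≡→≡
          (suc-injective (trans (sym (proj₂ left)) (proj₂ into)) , trans straight (sym (proj₁ into)))))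

  straight-left : ∀ {i} → StepRight (v i) (v (prev i)) → y (next i) ≡ y i →
                  StepRight (v (next i)) (v i)
  straight-left {i} into straight with UnitStep-sameRow {v i} {v (next i)} (step i) (sym straight)
  ... | inj₁ right = ⊥-elim (no-backtrack i (×-≡,≡→≡
          (trans (proj₂ right) (sym (proj₂ into)) , trans straight (proj₁ into))))
  ... | inj₂ left = left

  run-right : ∀ fuel i → StepRight (v (prev i)) (v i) → m ≤ fuel + x i → RunEndFrom i _≤_
  run-right zero i _ m≤xi = ⊥-elim (<⇒≱ (bounded i) m≤xi)
  run-right (suc fuel) i into m≤ with end-or-straight i (proj₁ into)
  ... | inj₁ end = ends-at i end refl ≤-refl
  ... | inj₂ straight =
    RunEndFrom-next straight
      (run-right fuel (next i) (entering (λ p → StepRight p (v (next i))) right) m≤fuel+x′)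
      (λ far → <⇒≤ (subst (_≤ _) (proj₂ right) far))
    where
    right = straight-right into straight
    m≤fuel+x′ : m ≤ fuel + x (next i)
    m≤fuel+x′ = ≤-trans m≤
      (≤-reflexive (trans (sym (+-suc fuel (x i))) (cong (fuel +_) (sym (proj₂ right)))))

  run-left : ∀ fuel i → StepRight (v i) (v (prev i)) → x i < fuel → RunEndFrom i (λ o t → t ≤ o)
  run-left (suc fuel) i into x<fuel with end-or-straight i (sym (proj₁ into))
  ... | inj₁ end = ends-at i end refl ≤-refl
  ... | inj₂ straight =
    RunEndFrom-next straight
      (run-left fuel (next i) (entering (StepRight (v (next i))) left)
        (subst (_≤ fuel) (proj₂ left) (≤-pred x<fuel)))
      (λ near → ≤-trans near (subst (x (next i) ≤_) (sym (proj₂ left)) (n≤1+n _)))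
    where
    left = straight-left into straight

  run-end : ∀ i → y (next i) ≡ y i → RunEndFrom i (λ o t → Beyond o (x (next i)) t)
  run-end i straight with UnitStep-sameRow {v i} {v (next i)} (step i) (sym straight)
  ... | inj₁ right =
    RunEndFrom-next straight
      (run-right m (next i) (entering (λ p → StepRight p (v (next i))) right) (m≤m+n m _))
      (λ far → inj₁ (proj₂ right , subst (_≤ _) (proj₂ right) far))
  ... | inj₂ left =
    RunEndFrom-next straight
      (run-left (suc (x (next i))) (next i) (entering (StepRight (v (next i))) left) ≤-refl)
      (λ near → inj₂ (proj₂ left , subst (_ <_) (sym (proj₂ left)) (s≤s near)))

Turn : ∀ {L} → (Fin L → ℕ × ℕ) → Fin L → Set
Turn v k = (proj₂ (v (cycPred k)) ≡ proj₂ (v k) × proj₁ (v k) ≡ proj₁ (v (cycSucc k)))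
         ⊎ (proj₁ (v (cycPred k)) ≡ proj₁ (v k) × proj₂ (v k) ≡ proj₂ (v (cycSucc k)))

OnCross : ℕ × ℕ → ℕ × ℕ → Set
OnCross c t = proj₂ t ≡ proj₂ c ⊎ proj₁ t ≡ proj₁ c

module CycleTurns {L : ℕ} (v : Fin L → ℕ × ℕ) (long : 3 ≤ L) (injective : Injective _≡_ _≡_ v)
  (m : ℕ) (bounded : ∀ i → proj₁ (v i) < m) (step : ∀ i → UnitStep (v i) (v (cycSucc i))) where

  step-back : ∀ i → UnitStep (v i) (v (cycPred i))
  step-back i = UnitStep-sym {v (cycPred i)}
    (subst (UnitStep (v (cycPred i)) ∘ v) (cycSucc-cycPred i) (step (cycPred i)))

  ahead≢behind : ∀ i → v (cycSucc i) ≢ v (cycPred i)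
  ahead≢behind i = cycSucc≢cycPred long i ∘ injective

  module Forward = StraightRuns v m bounded cycSucc cycPred cycPred-cycSucc ahead≢behind step
  module Backward =
    StraightRuns v m bounded cycPred cycSucc cycSucc-cycPred (≢-sym ∘ ahead≢behind) step-back
  open Forward using (x; y; ends-at)

  two-turns-on-row : ∀ i → y (cycSucc i) ≡ y i →
    Σ[ k₁ ∈ Fin L ] Σ[ k₂ ∈ Fin L ] v k₁ ≢ v k₂ × (Turn v k₁ × y k₁ ≡ y i) × (Turn v k₂ × y k₂ ≡ y i)
  two-turns-on-row i straight with Forward.run-end i straight | y (cycPred i) ≟ y i
  ... | ends-at k end row beyond | no bend =
    i , k , (λ e → Beyond⇒≢ beyond (cong proj₁ (sym e))) ,
    (inj₂ (sym (UnitStep-otherRow {v i} (step-back i) (≢-sym bend)) , sym straight) , refl) ,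
    (inj₁ end , row)
  ... | ends-at k₁ end₁ row₁ beyond₁ | yes straight′ with Backward.run-end i straight′
  ...   | Backward.ends-at k₂ (row-end₂ , column-end₂) row₂ beyond₂ =
    k₁ , k₂ , (Beyond-opposite beyond₁ beyond₂ x-ahead≢x-behind ∘ cong proj₁) ,
    (inj₁ end₁ , row₁) , (inj₂ (sym column-end₂ , sym row-end₂) , row₂)
    where
    x-ahead≢x-behind : x (cycSucc i) ≢ x (cycPred i)
    x-ahead≢x-behind e = ahead≢behind i (×-≡,≡→≡ (e , trans straight (sym straight′)))

turns-on-cross : ∀ {L} (v : Fin L → ℕ × ℕ) → 3 ≤ L → Injective _≡_ _≡_ v → (m n : ℕ) →
  (∀ i → proj₁ (v i) < m × proj₂ (v i) < n) → (∀ i → UnitStep (v i) (v (cycSucc i))) →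
  ∀ i → Σ[ k₁ ∈ Fin L ] Σ[ k₂ ∈ Fin L ] v k₁ ≢ v k₂ ×
          (Turn v k₁ × OnCross (v i) (v k₁)) × (Turn v k₂ × OnCross (v i) (v k₂))
turns-on-cross v long injective m n bounded step i with proj₂ (v (cycSucc i)) ≟ proj₂ (v i)
... | yes straight =
  let k₁ , k₂ , k₁≢k₂ , (turn₁ , row₁) , (turn₂ , row₂) =
        CycleTurns.two-turns-on-row v long injective m (proj₁ ∘ bounded) step i straight
  in k₁ , k₂ , k₁≢k₂ , (turn₁ , inj₁ row₁) , (turn₂ , inj₁ row₂)
... | no bend =
  let k₁ , k₂ , k₁≢k₂ , (turn₁ , column₁) , (turn₂ , column₂) =
        CycleTurns.two-turns-on-row (swap ∘ v) long (injective ∘ cong swap) n (proj₂ ∘ bounded)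
          (λ j → UnitStep-swap {v j} (step j)) i
          (sym (UnitStep-otherRow {v i} (step i) (≢-sym bend)))
  in k₁ , k₂ , k₁≢k₂ ∘ cong swap , (Sum.swap turn₁ , inj₂ column₁) , (Sum.swap turn₂ , inj₂ column₂)

coords : ∀ {m n} → Cell m n → ℕ × ℕ
coords c = toℕ (proj₁ c) , toℕ (proj₂ c)

coords-injective : ∀ {m n} → Injective _≡_ _≡_ (coords {m} {n})
coords-injective e = ×-≡,≡→≡ (toℕ-injective (cong proj₁ e) , toℕ-injective (cong proj₂ e))

Turn⇒IsTurn : ∀ {m n} (C : Cycle m n) k →
              Turn (coords ∘ Cycle.vertex C) k → IsTurn C (Cycle.vertex C k)
Turn⇒IsTurn C k turn =
  k , refl , Sum.map (Product.map toℕ-injective toℕ-injective)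
                     (Product.map toℕ-injective toℕ-injective) turn

OnCross⇒InRowOrColumn : ∀ {m n} {c t : Cell m n} → OnCross (coords c) (coords t) → InRowOrColumn c t
OnCross⇒InRowOrColumn = Sum.map toℕ-injective toℕ-injective

corollary5 : (m n : ℕ) (C : Cycle m n) (c : Cell m n) → OnCycle C c →
    Σ (Cell m n) λ t₁ → Σ (Cell m n) λ t₂ → t₁ ≢ t₂ ×
      (IsTurn C t₁ × InRowOrColumn c t₁) × (IsTurn C t₂ × InRowOrColumn c t₂)
corollary5 m n C c (i , refl) =
  let k₁ , k₂ , k₁≢k₂ , (turn₁ , cross₁) , (turn₂ , cross₂) =
        turns-on-cross (coords ∘ vertex) len≥3 (distinct ∘ coords-injective) m n
          (λ j → toℕ<n (proj₁ (vertex j)) , toℕ<n (proj₂ (vertex j))) adjacent i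
  in vertex k₁ , vertex k₂ , k₁≢k₂ ∘ cong coords ,
     (Turn⇒IsTurn C k₁ turn₁ , OnCross⇒InRowOrColumn cross₁) ,
     (Turn⇒IsTurn C k₂ turn₂ , OnCross⇒InRowOrColumn cross₂)
  where open Cycle C
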